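{- Let $r_1, r_2 \ge 2$ and $b_1, b_2 \ge 1$ be integers. Suppose that for all integers $k_1 \ge 1$, $n_1\ge r_1k_1$, and all partitions $\mathcal{P}$ of $[n_1]$ with all parts of size at most $b_1$, we have $\chi(\mathrm{KG}^{r_1}(n_1, k_1; \mathcal{P})) \ge \left\lceil \frac{n_1 - r_1(k_1-1)}{r_1-1} \right\rceil$, and suppose that for all integers $k_2 \ge 1$, $n_2\ge r_2k_2$, and all partitions $\mathcal{Q}$ of $[n_2]$ with all parts of size at most $b_2$, we have $\chi(\mathrm{KG}^{r_2}(n_2, k_2 ;\mathcal{Q})) \ge \left\lceil \frac{n_2 - r_2(k_2-1)}{r_2-1}\right\rceil$. Then for all integers $k \ge 1$, $n\ge r_1r_2k$, and all partitions $\mathcal{R}$ of $[n]$ with all parts of size at most $b_1b_2$, we have $\chi(\mathrm{KG}^{r_1r_2}(n,k;\mathcal{R})) \ge \left\lceil \frac{n - r_1r_2(k-1)}{r_1r_2-1}\right\rceil$.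
   Context: For a hypergraph $H$ (a set of hyperedges, each a multisubset of the vertex set), an $m$-coloring is a map from the vertices to $[m]$ such that no hyperedge is monochromatic; $\chi(H)$ is the least such $m$. For an integer $r\ge2$ and a partition $\mathcal{P}=\{P_1,\dots,P_\ell\}$ of $[n]$, $\mathrm{KG}^r(n,k;\mathcal{P})$ is the $r$-uniform hypergraph whose vertices are the $k$-element subsets $\sigma\subseteq[n]$ with $|\sigma\cap P_i|\le 1$ for all $i$, and whose hyperedges are the collections of $r$ such sets that are pairwise disjoint. -}

module Defs where

open import Data.Nat using (ℕ; zero; suc; _+_; _*_; _∸_; _≤_; _/_)
open import Data.Fin using (Fin)
open import Data.Fin.Subset using (Subset; _∈_; ∣_∣)
open import Data.Vec using (tabulate)
open import Data.Bool using (Bool)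
open import Data.Empty using (⊥)
open import Data.Product using (_×_; Σ)
open import Relation.Nullary using (¬_)
open import Relation.Nullary.Decidable using (⌊_⌋)
open import Relation.Binary.PropositionalEquality using (_≡_; _≢_)
import Data.Nat as N

-- Ceiling division ⌈ a / d ⌉ for d ≥ 1 (value at d = 0 is an irrelevant junk 0).
ceilDiv : ℕ → ℕ → ℕ
ceilDiv a zero = 0
ceilDiv a (suc d) = (a + d) / suc d

-- A partition of [n] is represented by a labelling p : Fin n → ℕ;
-- the parts are the nonempty fibres of p.
-- The part with label j, as a subset of [n].
part : {n : ℕ} → (Fin n → ℕ) → ℕ → Subset n
part p j = tabulate (λ x → ⌊ p x N.≟ j ⌋)

PartsAtMost : {n : ℕ} → ℕ → (Fin n → ℕ) → Set
PartsAtMost b p = ∀ j → ∣ part p j ∣ ≤ b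

IsVertex : {n : ℕ} → ℕ → (Fin n → ℕ) → Subset n → Set
IsVertex {n} k p σ =
  ∣ σ ∣ ≡ k × (∀ (x y : Fin n) → x ∈ σ → y ∈ σ → p x ≡ p y → x ≡ y)

Disjoint : {n : ℕ} → Subset n → Subset n → Set
Disjoint {n} σ τ = ∀ (x : Fin n) → x ∈ σ → x ∈ τ → ⊥

-- A proper m-colouring of KG^r(n,k;P): a map from vertices to [m] such that no
-- hyperedge (r pairwise disjoint vertices) is monochromatic.
-- (Pairwise disjointness of the r vertices, with k ≥ 1, makes them distinct.)
IsProperColoring : (r n k m : ℕ) (p : Fin n → ℕ) →
  ((σ : Subset n) → IsVertex k p σ → Fin m) → Set
IsProperColoring r n k m p c =
  ∀ (e : Fin r → Subset n) (v : ∀ i → IsVertex k p (e i)) →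
    (∀ i j → i ≢ j → Disjoint (e i) (e j)) →
    ¬ (∀ i j → c (e i) (v i) ≡ c (e j) (v j))

HasColoring : (r n k m : ℕ) (p : Fin n → ℕ) → Set
HasColoring r n k m p =
  Σ ((σ : Subset n) → IsVertex k p σ → Fin m) (IsProperColoring r n k m p)

ChiAtLeast : (r n k : ℕ) (p : Fin n → ℕ) (t : ℕ) → Set
ChiAtLeast r n k p t = ∀ m → HasColoring r n k m p → t ≤ m

KneserBound : (r b : ℕ) → Set
KneserBound r b =
  ∀ (k n : ℕ) (p : Fin n → ℕ) → 1 ≤ k → r * k ≤ n → PartsAtMost b p →
    ChiAtLeast r n k p (ceilDiv (n ∸ r * (k ∸ 1)) (r ∸ 1))

module Submission where

-- Let c be a proper m-colouring of KG^{r₁r₂}(n,k;R), where R has parts of size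
-- ≤ b₁b₂, and suppose m(r₁r₂-1) < n - r₁r₂(k-1).  Split every part of R into at
-- most b₂ blocks of size ≤ b₁; this gives a finer partition P of [n] with parts
-- ≤ b₁ such that every P-transversal S meets each part of R at most b₂ times.
-- Put k₁ = r₂(k-1) + (r₂-1)m + 1.  For a vertex S of KG^{r₁}(n,k₁;P), the
-- hypergraph KG^{r₂}(S,k;R|S) has chromatic number > m by the r₂-hypothesis, so
-- c restricted to it has a monochromatic hyperedge.  Colouring S by the colour
-- of such an edge is a proper m-colouring of KG^{r₁}(n,k₁;P): r₁ disjoint
-- blocks with equal colours would yield r₁r₂ disjoint vertices of one colour.
-- The r₁-hypothesis then contradicts the choice of k₁.  Choosing one edge per S
-- is classical, so that step is done under a double negation, which is harmless
-- because the goal is an inequality between naturals.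

open import Defs
open import Data.Nat using (ℕ; zero; suc; _+_; _*_; _∸_; _≤_; _<_; z≤n; s≤s; s≤s⁻¹; NonZero; >-nonZero)
open import Data.Nat.Properties
open import Data.Nat.DivMod
open import Data.Fin as F using (Fin; combine; remQuot; toℕ; fromℕ<; inject≤)
import Data.Fin.Properties as FP
open import Data.Fin.Subset using (Subset; _∈_; _⊆_; ∣_∣)
open import Data.Vec using ([]; _∷_; lookup; here; there)
open import Data.Vec.Properties using ([]=⇒lookup; lookup∘tabulate)
open import Data.Bool using (Bool; true; false)
open import Data.Bool.Properties using (T-≡)
open import Data.Empty using (⊥-elim)
open import Data.Product using (_×_; Σ; _,_; uncurry)
open import Function using (_∘_)
open import Function.Bundles using (Equivalence)
open import Relation.Nullary using (¬_; yes; no)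
open import Relation.Nullary.Decidable using (⌊_⌋; toWitness; fromWitness)
open import Relation.Binary.PropositionalEquality
open import Data.Nat.Tactic.RingSolver using (solve-∀)

≤⇒ceilDiv≤ : ∀ a e m → 1 ≤ e → a ≤ m * e → ceilDiv a e ≤ m
≤⇒ceilDiv≤ a (suc d) m _ a≤me = s≤s⁻¹ (m<n*o⇒m/o<n {a + d} {suc m} {suc d} bound)
  where
  bound : a + d < suc m * suc d
  bound = subst (a + d <_) (+-comm (m * suc d) (suc d)) (+-mono-≤-< a≤me (n<1+n d))

*<⇒<ceilDiv : ∀ a e m → 1 ≤ e → m * e < a → m < ceilDiv a e
*<⇒<ceilDiv a (suc d) m _ me<a = begin-strict
  m                      <⟨ n<1+n m ⟩
  suc m                  ≡⟨ sym (m*n/n≡m (suc m) (suc d)) ⟩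
  suc m * suc d / suc d  ≤⟨ /-monoˡ-≤ (suc d) grow ⟩
  (a + d) / suc d        ∎
  where
  open ≤-Reasoning
  grow : suc m * suc d ≤ a + d
  grow = subst (_≤ a + d) (cong suc (+-comm (m * suc d) d)) (+-mono-≤ me<a (≤-refl {d}))

emb : ∀ {n} (S : Subset n) → Fin ∣ S ∣ → Fin n
emb (true ∷ S) F.zero = F.zero
emb (true ∷ S) (F.suc y) = F.suc (emb S y)
emb (false ∷ S) y = F.suc (emb S y)

emb-∈ : ∀ {n} (S : Subset n) y → emb S y ∈ S
emb-∈ (true ∷ S) F.zero = here
emb-∈ (true ∷ S) (F.suc y) = there (emb-∈ S y)
emb-∈ (false ∷ S) y = there (emb-∈ S y)

emb-injective : ∀ {n} (S : Subset n) y y′ → emb S y ≡ emb S y′ → y ≡ y′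
emb-injective (true ∷ S) F.zero F.zero _ = refl
emb-injective (true ∷ S) (F.suc y) (F.suc y′) e =
  cong F.suc (emb-injective S y y′ (FP.suc-injective e))
emb-injective (false ∷ S) y y′ e = emb-injective S y y′ (FP.suc-injective e)

img : ∀ {n} (S : Subset n) → Subset ∣ S ∣ → Subset n
img [] _ = []
img (true ∷ S) (t ∷ τ) = t ∷ img S τ
img (false ∷ S) τ = false ∷ img S τ

∣img∣ : ∀ {n} (S : Subset n) τ → ∣ img S τ ∣ ≡ ∣ τ ∣
∣img∣ [] [] = refl
∣img∣ (true ∷ S) (true ∷ τ) = cong suc (∣img∣ S τ)
∣img∣ (true ∷ S) (false ∷ τ) = ∣img∣ S τ
∣img∣ (false ∷ S) τ = ∣img∣ S τ

img-⊆ : ∀ {n} (S : Subset n) τ → img S τ ⊆ S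
img-⊆ (true ∷ S) (t ∷ τ) here = here
img-⊆ (true ∷ S) (t ∷ τ) (there p) = there (img-⊆ S τ p)
img-⊆ (false ∷ S) τ (there p) = there (img-⊆ S τ p)

∈img⇒ : ∀ {n} (S : Subset n) τ x → x ∈ img S τ → Σ (Fin ∣ S ∣) λ y → y ∈ τ × emb S y ≡ x
∈img⇒ (true ∷ S) (t ∷ τ) F.zero here = F.zero , here , refl
∈img⇒ (true ∷ S) (t ∷ τ) (F.suc x) (there p) with ∈img⇒ S τ x p
... | y , y∈τ , refl = F.suc y , there y∈τ , refl
∈img⇒ (false ∷ S) τ (F.suc x) (there p) with ∈img⇒ S τ x p
... | y , y∈τ , refl = y , y∈τ , refl

injectiveOn⇒∣∣≤ : ∀ {n} b (σ : Subset n) (f : Fin n → ℕ) →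
  (∀ x → x ∈ σ → f x < b) → (∀ x y → x ∈ σ → y ∈ σ → f x ≡ f y → x ≡ y) → ∣ σ ∣ ≤ b
injectiveOn⇒∣∣≤ b σ f f<b f-inj = FP.injective⇒≤ g-injective
  where
  g : Fin ∣ σ ∣ → Fin b
  g y = fromℕ< (f<b (emb σ y) (emb-∈ σ y))
  g-injective : ∀ {y y′} → g y ≡ g y′ → y ≡ y′
  g-injective {y} {y′} e = emb-injective σ y y′ (f-inj _ _ (emb-∈ σ y) (emb-∈ σ y′) (begin
    f (emb σ y)   ≡⟨ sym (FP.toℕ-fromℕ< _) ⟩
    toℕ (g y)     ≡⟨ cong toℕ e ⟩
    toℕ (g y′)    ≡⟨ FP.toℕ-fromℕ< _ ⟩
    f (emb σ y′)  ∎))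
    where open ≡-Reasoning

∈part⇒ : ∀ {n} (p : Fin n → ℕ) j x → x ∈ part p j → p x ≡ j
∈part⇒ p j x x∈ = toWitness (Equivalence.from T-≡ (begin
  ⌊ p x ≟ j ⌋          ≡⟨ sym (lookup∘tabulate (λ y → ⌊ p y ≟ j ⌋) x) ⟩
  lookup (part p j) x  ≡⟨ []=⇒lookup x∈ ⟩
  true                 ∎))
  where open ≡-Reasoning

addIf : Bool → ℕ → ℕ
addIf true r = suc r
addIf false r = r

∣∷∣ : ∀ {n} (t : Bool) (S : Subset n) → ∣ t ∷ S ∣ ≡ addIf t ∣ S ∣
∣∷∣ true S = refl
∣∷∣ false S = refl

∈-head : ∀ {n} (R : Fin (suc n) → ℕ) j → R F.zero ≡ j → ⌊ R F.zero ≟ j ⌋ ≡ true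
∈-head R j e = Equivalence.to T-≡ (fromWitness e)

rankIn : ∀ {n} → (Fin n → ℕ) → ℕ → Fin n → ℕ
rankIn R j F.zero = 0
rankIn R j (F.suc x) = addIf ⌊ R F.zero ≟ j ⌋ (rankIn (R ∘ F.suc) j x)

rankIn<∣part∣ : ∀ {n} (R : Fin n → ℕ) j x → R x ≡ j → rankIn R j x < ∣ part R j ∣
rankIn<∣part∣ R j F.zero e
  rewrite ∣∷∣ ⌊ R F.zero ≟ j ⌋ (part (R ∘ F.suc) j) | ∈-head R j e = s≤s z≤n
rankIn<∣part∣ R j (F.suc x) e
  rewrite ∣∷∣ ⌊ R F.zero ≟ j ⌋ (part (R ∘ F.suc) j) with ⌊ R F.zero ≟ j ⌋
... | true = s≤s (rankIn<∣part∣ (R ∘ F.suc) j x e)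
... | false = rankIn<∣part∣ (R ∘ F.suc) j x e

rankIn-injective : ∀ {n} (R : Fin n → ℕ) j x y → R x ≡ j → R y ≡ j →
  rankIn R j x ≡ rankIn R j y → x ≡ y
rankIn-injective R j F.zero F.zero _ _ _ = refl
rankIn-injective R j F.zero (F.suc y) Rx _ e rewrite ∈-head R j Rx with () ← e
rankIn-injective R j (F.suc x) F.zero _ Ry e rewrite ∈-head R j Ry with () ← e
rankIn-injective R j (F.suc x) (F.suc y) Rx Ry e =
  cong F.suc (rankIn-injective (R ∘ F.suc) j x y Rx Ry (addIf-injective ⌊ R F.zero ≟ j ⌋ e))
  where
  addIf-injective : ∀ t {a b} → addIf t a ≡ addIf t b → a ≡ b
  addIf-injective true = suc-injective
  addIf-injective false e = e

rank : ∀ {n} → (Fin n → ℕ) → Fin n → ℕ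
rank R x = rankIn R (R x) x

rank-injective : ∀ {n} (R : Fin n → ℕ) x y → R x ≡ R y → rank R x ≡ rank R y → x ≡ y
rank-injective R x y e same =
  rankIn-injective R (R x) x y refl (sym e) (trans same (cong (λ j → rankIn R j y) (sym e)))

rank<∣part∣ : ∀ {n} (R : Fin n → ℕ) x → rank R x < ∣ part R (R x) ∣
rank<∣part∣ R x = rankIn<∣part∣ R (R x) x refl

*+-injective : ∀ b .{{_ : NonZero b}} a a′ q q′ → q < b → q′ < b →
  a * b + q ≡ a′ * b + q′ → a ≡ a′ × q ≡ q′
*+-injective b a a′ q q′ q<b q′<b e = a≡a′ , q≡q′
  where
  digit : ∀ a q → q < b → (a * b + q) % b ≡ q
  digit a q q<b = begin
    (a * b + q) % b  ≡⟨ cong (_% b) (+-comm (a * b) q) ⟩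
    (q + a * b) % b  ≡⟨ [m+kn]%n≡m%n q a b ⟩
    q % b            ≡⟨ m<n⇒m%n≡m q<b ⟩
    q                ∎
    where open ≡-Reasoning
  q≡q′ : q ≡ q′
  q≡q′ = trans (sym (digit a q q<b)) (trans (cong (_% b) e) (digit a′ q′ q′<b))
  a≡a′ : a ≡ a′
  a≡a′ = *-cancelʳ-≡ a a′ b (+-cancelʳ-≡ q _ _ (trans e (cong (a′ * b +_) (sym q≡q′))))

Transversal : ∀ {n} → (Fin n → ℕ) → Subset n → Set
Transversal {n} p S = ∀ (x y : Fin n) → x ∈ S → y ∈ S → p x ≡ p y → x ≡ y

-- Cutting every part of R (of size ≤ b₁b₂) into b₂ consecutive blocks of size
-- ≤ b₁ by rank gives a labelling P with parts ≤ b₁; a P-transversal uses at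
-- most one element of each block, hence at most b₂ elements of each R-part.
module Refinement (b₁ b₂ : ℕ) .{{_ : NonZero b₁}} .{{_ : NonZero b₂}}
  {n : ℕ} (R : Fin n → ℕ) (R-parts : PartsAtMost (b₁ * b₂) R) where

  block : Fin n → ℕ
  block x = rank R x / b₁

  block<b₂ : ∀ x → block x < b₂
  block<b₂ x = m<n*o⇒m/o<n (≤-trans (rank<∣part∣ R x)
    (subst (∣ part R (R x) ∣ ≤_) (*-comm b₁ b₂) (R-parts (R x))))

  P : Fin n → ℕ
  P x = R x * b₂ + block x

  -- Within a P-part the offsets rank % b₁ are distinct, so P-parts have size ≤ b₁.
  P-parts : PartsAtMost b₁ P
  P-parts j =
    injectiveOn⇒∣∣≤ b₁ (part P j) (λ x → rank R x % b₁) (λ x _ → m%n<n _ b₁) offset-injective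
    where
    offset-injective : ∀ x y → x ∈ part P j → y ∈ part P j → rank R x % b₁ ≡ rank R y % b₁ → x ≡ y
    offset-injective x y x∈ y∈ e
      with *+-injective b₂ (R x) (R y) (block x) (block y) (block<b₂ x) (block<b₂ y)
             (trans (∈part⇒ P j x x∈) (sym (∈part⇒ P j y y∈)))
    ... | sameR , sameBlock = rank-injective R x y sameR (begin
      rank R x                           ≡⟨ m≡m%n+[m/n]*n (rank R x) b₁ ⟩
      rank R x % b₁ + block x * b₁       ≡⟨ cong₂ (λ u v → u + v * b₁) e sameBlock ⟩
      rank R y % b₁ + block y * b₁       ≡⟨ sym (m≡m%n+[m/n]*n (rank R y) b₁) ⟩
      rank R y                           ∎)
      where open ≡-Reasoning

  -- Within an R-part of a P-transversal the blocks are distinct, so there are ≤ b₂.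
  transversal-parts : ∀ S → Transversal P S → PartsAtMost b₂ (R ∘ emb S)
  transversal-parts S S-transversal j =
    injectiveOn⇒∣∣≤ b₂ (part Q j) (block ∘ emb S) (λ y _ → block<b₂ (emb S y)) block-injective
    where
    Q : Fin ∣ S ∣ → ℕ
    Q = R ∘ emb S
    block-injective : ∀ y y′ → y ∈ part Q j → y′ ∈ part Q j →
      block (emb S y) ≡ block (emb S y′) → y ≡ y′
    block-injective y y′ y∈ y′∈ e = emb-injective S y y′
      (S-transversal (emb S y) (emb S y′) (emb-∈ S y) (emb-∈ S y′)
        (cong₂ (λ u v → u * b₂ + v) (trans (∈part⇒ Q j y y∈) (sym (∈part⇒ Q j y′ y′∈))) e))

PairwiseDisjoint : ∀ {n r} → (Fin r → Subset n) → Set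
PairwiseDisjoint {r = r} e = ∀ (i j : Fin r) → i ≢ j → Disjoint (e i) (e j)

img-vertex : ∀ {n k} (R : Fin n → ℕ) (S : Subset n) τ →
  IsVertex k (R ∘ emb S) τ → IsVertex k R (img S τ)
img-vertex R S τ (∣τ∣≡k , τ-transversal) = trans (∣img∣ S τ) ∣τ∣≡k , transversal
  where
  transversal : Transversal R (img S τ)
  transversal x x′ x∈ x′∈ e with ∈img⇒ S τ x x∈ | ∈img⇒ S τ x′ x′∈
  ... | y , y∈ , refl | y′ , y′∈ , refl = cong (emb S) (τ-transversal y y′ y∈ y′∈ e)

img-disjoint : ∀ {n} (S : Subset n) τ τ′ → Disjoint τ τ′ → Disjoint (img S τ) (img S τ′)
img-disjoint S τ τ′ d x x∈ x∈′ with ∈img⇒ S τ x x∈ | ∈img⇒ S τ′ x x∈′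
... | y , y∈ , refl | y′ , y′∈ , e = d y y∈ (subst (_∈ τ′) (emb-injective S y′ y e) y′∈)

record MonoEdgeIn {n k m : ℕ} (r : ℕ) {R : Fin n → ℕ}
  (c : (σ : Subset n) → IsVertex k R σ → Fin m) (S : Subset n) : Set where
  field
    colour   : Fin m
    edge     : Fin r → Subset n
    vertex   : ∀ i → IsVertex k R (edge i)
    disjoint : PairwiseDisjoint edge
    mono     : ∀ i → c (edge i) (vertex i) ≡ colour
    inside   : ∀ i → edge i ⊆ S

-- If KG^r(|S|,k;R|S) has no proper m-colouring, then the restriction of c to it
-- is not proper, i.e. (classically) c has a monochromatic hyperedge inside S.
noColouring⇒¬¬mono : ∀ {n k m r} (R : Fin n → ℕ) (c : (σ : Subset n) → IsVertex k R σ → Fin m)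
  (S : Subset n) → Fin r → ¬ HasColoring r ∣ S ∣ k m (R ∘ emb S) → ¬ ¬ MonoEdgeIn r c S
noColouring⇒¬¬mono {n} {k} {m} {r} R c S i₀ noColouring noMono =
  noColouring (restricted , proper)
  where
  restricted : (τ : Subset ∣ S ∣) → IsVertex k (R ∘ emb S) τ → Fin m
  restricted τ v = c (img S τ) (img-vertex R S τ v)
  proper : IsProperColoring r ∣ S ∣ k m (R ∘ emb S) restricted
  proper e v d same = noMono record
    { colour   = restricted (e i₀) (v i₀)
    ; edge     = img S ∘ e
    ; vertex   = λ i → img-vertex R S (e i) (v i)
    ; disjoint = λ i j i≢j → img-disjoint S (e i) (e j) (d i j i≢j)
    ; mono     = λ i → same i i₀
    ; inside   = λ i → img-⊆ S (e i)
    }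

flatten-disjoint : ∀ {n r₁ r₂} (S : Fin r₁ → Subset n) (E : Fin r₁ → Fin r₂ → Subset n) →
  PairwiseDisjoint S → (∀ i → PairwiseDisjoint (E i)) → (∀ i j → E i j ⊆ S i) →
  PairwiseDisjoint (uncurry E ∘ remQuot r₂)
flatten-disjoint {r₁ = r₁} {r₂} S E S-disjoint E-disjoint E⊆S ij ij′ ij≢ij′ =
  pair-disjoint (remQuot r₂ ij) (remQuot r₂ ij′)
    (λ e → ij≢ij′ (trans (sym (FP.combine-remQuot {r₁} r₂ ij))
                    (trans (cong (uncurry combine) e) (FP.combine-remQuot {r₁} r₂ ij′))))
  where
  pair-disjoint : ∀ p p′ → p ≢ p′ → Disjoint (uncurry E p) (uncurry E p′)
  pair-disjoint (i , j) (i′ , j′) p≢p′ with i F.≟ i′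
  ... | no i≢i′ = λ x x∈ x∈′ → S-disjoint i i′ i≢i′ x (E⊆S i j x∈) (E⊆S i′ j′ x∈′)
  ... | yes refl = E-disjoint i j j′ (λ j≡j′ → p≢p′ (cong (i ,_) j≡j′))

monoBlocks⇒colouring : ∀ {n k m r₁ r₂ k₁} (R P : Fin n → ℕ)
  (c : (σ : Subset n) → IsVertex k R σ → Fin m) → IsProperColoring (r₁ * r₂) n k m R c →
  ((S : Subset n) → IsVertex k₁ P S → MonoEdgeIn r₂ c S) → HasColoring r₁ n k₁ m P
monoBlocks⇒colouring {n} {k} {m} {r₁} {r₂} {k₁} R P c c-proper block = blockColour , proper
  where
  open MonoEdgeIn using (edge; vertex; disjoint; mono; inside)
  blockColour : (S : Subset n) → IsVertex k₁ P S → Fin m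
  blockColour S v = MonoEdgeIn.colour (block S v)
  proper : IsProperColoring r₁ n k₁ m P blockColour
  proper e v d same = c-proper
    (uncurry E ∘ remQuot r₂) (uncurry V ∘ remQuot r₂)
    (flatten-disjoint e E d (λ i → disjoint (B i)) (λ i → inside (B i)))
    (λ ij ij′ → trans (mono (B _) _) (trans (same _ _) (sym (mono (B _) _))))
    where
    B : ∀ i → MonoEdgeIn r₂ c (e i)
    B i = block (e i) (v i)
    E : Fin r₁ → Fin r₂ → Subset n
    E i = edge (B i)
    V : ∀ i j → IsVertex k R (E i j)
    V i = vertex (B i)

colouring-mono : ∀ {r n k m m′} (p : Fin n → ℕ) → m ≤ m′ →
  HasColoring r n k m p → HasColoring r n k m′ p
colouring-mono p m≤m′ (c , c-proper) =
  (λ σ v → inject≤ (c σ v) m≤m′) ,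
  (λ e v d same → c-proper e v d (λ i j → FP.inject≤-injective m≤m′ m≤m′ _ _ (same i j)))

-- Over the finitely many subsets of [n], ∀ commutes with ¬¬.
¬¬-shift : ∀ {n} {A : Subset n → Set} → (∀ S → ¬ ¬ A S) → ¬ ¬ (∀ S → A S)
¬¬-shift {zero} {A} h ¬all = h [] (λ a → ¬all (λ { [] → a }))
¬¬-shift {suc n} {A} h ¬all =
  ¬¬-shift {n} {A ∘ (false ∷_)} (h ∘ (false ∷_)) (λ f →
    ¬¬-shift {n} {A ∘ (true ∷_)} (h ∘ (true ∷_)) (λ t →
      ¬all (λ { (false ∷ S) → f S ; (true ∷ S) → t S })))

¬¬-→ : ∀ {B C : Set} → (B → ¬ ¬ C) → ¬ ¬ (B → C)
¬¬-→ f ¬imp = ¬imp (λ b → ⊥-elim (f b (λ c → ¬imp (λ _ → c))))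

<∸⇒+< : ∀ a b n → a < n ∸ b → a + b < n
<∸⇒+< a b n a<n∸b = m≤o∸n⇒m+n≤o (suc a) b≤n a<n∸b
  where
  b≤n : b ≤ n
  b≤n = <⇒≤ (m∸n≢0⇒n<m (λ e → <⇒≱ (subst (a <_) e a<n∸b) z≤n))

+<⇒<∸ : ∀ a b n → a + b < n → a < n ∸ b
+<⇒<∸ a b n = m+n≤o⇒m≤o∸n (suc a)

-- (r₁-1)m + r₁(r₂K + (r₂-1)m) = (r₁r₂-1)m + r₁r₂K, the identity behind k₁.
regroup : ∀ s₁ s₂ K m → m * s₁ + suc s₁ * (suc s₂ * K + m * s₂)
                       ≡ m * (s₂ + s₁ * suc s₂) + suc s₁ * suc s₂ * K
regroup = solve-∀

module BlockSize (s₁ s₂ K m n : ℕ) .{{_ : NonZero m}}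
  (below : m * (suc s₁ * suc s₂ ∸ 1) < n ∸ suc s₁ * suc s₂ * K) where

  k₁ : ℕ
  k₁ = suc (suc s₂ * K + m * s₂)

  outer-slack : m * s₁ + suc s₁ * (k₁ ∸ 1) < n
  outer-slack = subst (_< n) (sym (regroup s₁ s₂ K m)) (<∸⇒+< _ _ n below)

  -- m(r₁-1) < n - r₁(k₁-1): the outer graph would need more than m colours.
  outer-bound : m * s₁ < n ∸ suc s₁ * (k₁ ∸ 1)
  outer-bound = +<⇒<∸ _ _ n outer-slack

  outer-size : suc s₁ * k₁ ≤ n
  outer-size = begin
    suc s₁ * k₁                       ≡⟨ *-suc (suc s₁) (k₁ ∸ 1) ⟩
    suc s₁ + suc s₁ * (k₁ ∸ 1)        ≤⟨ +-monoˡ-≤ _ (s≤s (m≤n*m s₁ m)) ⟩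
    suc (m * s₁ + suc s₁ * (k₁ ∸ 1))  ≤⟨ outer-slack ⟩
    n                                 ∎
    where open ≤-Reasoning

  -- m(r₂-1) < k₁ - r₂(k-1): the inner graphs need more than m colours.
  inner-bound : m * s₂ < k₁ ∸ suc s₂ * K
  inner-bound = ≤-reflexive (sym (begin
    suc (suc s₂ * K + m * s₂) ∸ suc s₂ * K
      ≡⟨ cong (_∸ suc s₂ * K) (sym (+-suc (suc s₂ * K) (m * s₂))) ⟩
    suc s₂ * K + suc (m * s₂) ∸ suc s₂ * K
      ≡⟨ m+n∸m≡n (suc s₂ * K) (suc (m * s₂)) ⟩
    suc (m * s₂)
      ∎))
    where open ≡-Reasoning

  inner-size : suc s₂ * suc K ≤ k₁
  inner-size = begin
    suc s₂ * suc K             ≡⟨ *-suc (suc s₂) K ⟩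
    suc (s₂ + suc s₂ * K)      ≤⟨ s≤s (+-monoˡ-≤ _ (m≤n*m s₂ m)) ⟩
    suc (m * s₂ + suc s₂ * K)  ≡⟨ cong suc (+-comm (m * s₂) (suc s₂ * K)) ⟩
    k₁                         ∎
    where open ≤-Reasoning

one-below : ∀ s₁ s₂ K n → suc s₁ * suc s₂ * suc K ≤ n →
  1 * (suc s₁ * suc s₂ ∸ 1) < n ∸ suc s₁ * suc s₂ * K
one-below s₁ s₂ K n large = +<⇒<∸ _ _ n (subst (_≤ n) (sym (unfold s₁ s₂ K)) large)
  where
  unfold : ∀ s₁ s₂ K → suc (1 * (s₂ + s₁ * suc s₂) + suc s₁ * suc s₂ * K)
                      ≡ suc s₁ * suc s₂ * suc K
  unfold = solve-∀

bound⇒noColouring : ∀ {r n k m t} (p : Fin n → ℕ) → ChiAtLeast r n k p t → m < t →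
  ¬ HasColoring r n k m p
bound⇒noColouring p χ≥t m<t colouring = <⇒≱ m<t (χ≥t _ colouring)

module ProductStep (s₁ s₂ b₁ b₂ : ℕ) .{{_ : NonZero b₁}} .{{_ : NonZero b₂}}
  (1≤s₁ : 1 ≤ s₁) (1≤s₂ : 1 ≤ s₂)
  (h₁ : KneserBound (suc s₁) b₁) (h₂ : KneserBound (suc s₂) b₂)
  (K n : ℕ) (R : Fin n → ℕ) (R-parts : PartsAtMost (b₁ * b₂) R) where

  open Refinement b₁ b₂ R R-parts

  positiveColours : ∀ m .{{_ : NonZero m}} → HasColoring (suc s₁ * suc s₂) n (suc K) m R →
    ¬ (m * (suc s₁ * suc s₂ ∸ 1) < n ∸ suc s₁ * suc s₂ * K)
  positiveColours m (c , c-proper) below = ¬¬colouring outer-impossible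
    where
    open BlockSize s₁ s₂ K m n below

    inner-impossible : ∀ S → IsVertex k₁ P S →
      ¬ HasColoring (suc s₂) ∣ S ∣ (suc K) m (R ∘ emb S)
    inner-impossible S (∣S∣≡k₁ , S-transversal) = bound⇒noColouring (R ∘ emb S)
      (h₂ (suc K) ∣ S ∣ (R ∘ emb S) (s≤s z≤n)
        (subst (suc s₂ * suc K ≤_) (sym ∣S∣≡k₁) inner-size)
        (transversal-parts S S-transversal))
      (subst (λ s → m < ceilDiv (s ∸ suc s₂ * K) s₂) (sym ∣S∣≡k₁)
        (*<⇒<ceilDiv _ _ m 1≤s₂ inner-bound))

    -- Hence (classically) every such S holds a monochromatic edge of c, and these
    -- edges colour KG^{r₁}(n,k₁;P) with m colours ...
    ¬¬colouring : ¬ ¬ HasColoring (suc s₁) n k₁ m P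
    ¬¬colouring noColouring = ¬¬-shift
      (λ S → ¬¬-→ (λ v → noColouring⇒¬¬mono R c S F.zero (inner-impossible S v)))
      (noColouring ∘ monoBlocks⇒colouring R P c c-proper)

    -- ... which the bound h₁ forbids.
    outer-impossible : ¬ HasColoring (suc s₁) n k₁ m P
    outer-impossible = bound⇒noColouring P (h₁ k₁ n P (s≤s z≤n) outer-size P-parts)
      (*<⇒<ceilDiv _ _ m 1≤s₁ outer-bound)

  -- The same for any m; for m = 0 view the colouring as one with a single colour.
  anyColours : ∀ m → suc s₁ * suc s₂ * suc K ≤ n →
    HasColoring (suc s₁ * suc s₂) n (suc K) m R →
    ¬ (m * (suc s₁ * suc s₂ ∸ 1) < n ∸ suc s₁ * suc s₂ * K)
  anyColours zero large colouring _ =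
    positiveColours 1 (colouring-mono R z≤n colouring) (one-below s₁ s₂ K n large)
  anyColours (suc m) _ colouring = positiveColours (suc m) colouring

-- Either the colour count m already meets the bound, or m(r₁r₂-1) < n - r₁r₂(k-1),
-- which the product step refutes.
lemma3p2 : ∀ (r₁ r₂ b₁ b₂ : ℕ) → 2 ≤ r₁ → 2 ≤ r₂ → 1 ≤ b₁ → 1 ≤ b₂ →
    KneserBound r₁ b₁ → KneserBound r₂ b₂ → KneserBound (r₁ * r₂) (b₁ * b₂)
lemma3p2 (suc s₁) (suc s₂) b₁ b₂ (s≤s 1≤s₁) (s≤s 1≤s₂) 1≤b₁ 1≤b₂ h₁ h₂
         (suc K) n R (s≤s z≤n) large R-parts m colouring
  with n ∸ suc s₁ * suc s₂ * K ≤? m * (suc s₁ * suc s₂ ∸ 1)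
... | yes enough = ≤⇒ceilDiv≤ _ _ m 1≤e enough
  where
  1≤e : 1 ≤ suc s₁ * suc s₂ ∸ 1
  1≤e = ≤-trans 1≤s₂ (m≤m+n s₂ _)
... | no tooFew = ⊥-elim (ProductStep.anyColours s₁ s₂ b₁ b₂
  {{>-nonZero 1≤b₁}} {{>-nonZero 1≤b₂}} 1≤s₁ 1≤s₂ h₁ h₂ K n R R-parts
  m large colouring (≰⇒> tooFew))
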